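{- Suppose that $A, B, B^*, C \in \mathcal K_\lambda$ and $b \in B \setminus A$ are such that $A <_{\mathcal K} B \leq_{\mathcal K} B^*$, $A <_{\mathcal K} C$, and $(A, B, b) \in \mathcal K^{3,\mathrm{bs}}$. If $C$ witnesses the non-uniqueness of $(A, B, b)$, then it also witnesses the non-uniqueness of $(A, B^*, b)$.
   Context: $\mathfrak s=(\mathcal K,\downarrow,S^{\mathrm{bs}})$ is a pre-$\lambda$-frame (AEC $\mathcal K$ with $\mathrm{LS}(\mathcal K)\leq\lambda$, basic types $S^{\mathrm{bs}}(A)\subseteq S^{\mathrm{na}}(A)$ for $A\in\mathcal K_\lambda$, and an isomorphism-invariant monotone non-forking relation $\downarrow$; "$\mathrm{tp}(c/B;C)$ does not fork over $A$" means $\downarrow(A,B,c,C)$) and $\mathcal K_\lambda$ has the amalgamation property. $\mathcal K^{3,\mathrm{bs}}$: triples $(A,B,b)$ with $A<_{\mathcal K}B$ in $\mathcal K_\lambda$, $b\in B\setminus A$, $\mathrm{tp}(b/A;B)\in S^{\mathrm{bs}}(A)$. Two $\lambda$-amalgamations of $B$ and $C$ over $A$ are equivalent if they embed compatibly into a common model. $C\in\mathcal K_\lambda$ with $A<_{\mathcal K}C$ witnesses the non-uniqueness of $(A,B,b)$ if there are two non-equivalent $\lambda$-amalgamations $(f^D_B,\mathrm{id}_C,D)$, $(f^F_B,\mathrm{id}_C,F)$ of $B$ and $C$ over $A$ with $\mathrm{tp}(f^D_B(b)/C;D)=\mathrm{tp}(f^F_B(b)/C;F)$ not forking over $A$. 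-}

module Defs where

open import Level using (Level; _⊔_) renaming (suc to lsuc)
open import Data.Product using (Σ; Σ-syntax; ∃; ∃-syntax; _×_; _,_)
open import Relation.Binary.PropositionalEquality using (_≡_; _≢_)
open import Relation.Nullary using (¬_)

-- The λ-part K_λ of an AEC K (with LS(K) ≤ λ), presented abstractly:
-- models of K_λ, their universes, K-embeddings, the strong-substructure
-- relation ≤_K (with its inclusion maps), and the amalgamation property.

record AECλ (o ℓ : Level) : Set (lsuc (o ⊔ ℓ)) where
  infix 4 _≤_
  field
    Model  : Set o
    El     : Model → Set ℓ
    Emb    : Model → Model → Set ℓ
    ⟦_⟧    : ∀ {M N} → Emb M N → El M → El N
    ⟦⟧-inj : ∀ {M N} (f : Emb M N) {x y : El M} → ⟦ f ⟧ x ≡ ⟦ f ⟧ y → x ≡ y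
    idE    : ∀ {M} → Emb M M
    ⟦idE⟧  : ∀ {M} (x : El M) → ⟦ idE {M} ⟧ x ≡ x
    _∘E_   : ∀ {M N P} → Emb N P → Emb M N → Emb M P
    ⟦∘E⟧   : ∀ {M N P} (g : Emb N P) (f : Emb M N) (x : El M) →
             ⟦ g ∘E f ⟧ x ≡ ⟦ g ⟧ (⟦ f ⟧ x)
    _≤_        : Model → Model → Set ℓ
    ≤-prop     : ∀ {M N} (p q : M ≤ N) → p ≡ q
    incl       : ∀ {M N} → M ≤ N → Emb M N
    ≤-refl     : ∀ {M} → M ≤ M
    incl-refl  : ∀ {M} (x : El M) → ⟦ incl (≤-refl {M}) ⟧ x ≡ x
    ≤-trans    : ∀ {M N P} → M ≤ N → N ≤ P → M ≤ P
    incl-trans : ∀ {M N P} (p : M ≤ N) (q : N ≤ P) (x : El M) →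
                 ⟦ incl (≤-trans p q) ⟧ x ≡ ⟦ incl q ⟧ (⟦ incl p ⟧ x)
    coherence  : ∀ {M₀ M₁ N} (p₀ : M₀ ≤ N) (p₁ : M₁ ≤ N) →
                 (∀ (x : El M₀) → ∃[ y ] ⟦ incl p₁ ⟧ y ≡ ⟦ incl p₀ ⟧ x) →
                 M₀ ≤ M₁
    amalgamation : ∀ {M N₁ N₂} (f₁ : Emb M N₁) (f₂ : Emb M N₂) →
                   Σ[ N ∈ Model ] Σ[ p ∈ N₁ ≤ N ] Σ[ g ∈ Emb N₂ N ]
                     (∀ (x : El M) → ⟦ incl p ⟧ (⟦ f₁ ⟧ x) ≡ ⟦ g ⟧ (⟦ f₂ ⟧ x))

module _ {o ℓ : Level} (K : AECλ o ℓ) where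
  open AECλ K

  -- A <_K B : A ≤_K B and A ≠ B
  Strict : ∀ {A B} → A ≤ B → Set ℓ
  Strict {A} {B} p = ∃[ y ] (∀ (x : El A) → ⟦ incl p ⟧ x ≢ y)

  NotIn : ∀ {A B} → A ≤ B → El B → Set ℓ
  NotIn {A} p b = ∀ (x : El A) → ⟦ incl p ⟧ x ≢ b

  -- Galois types: tp(a/A;M) = tp(b/A;N)
  TpEq : ∀ {A M N} → A ≤ M → A ≤ N → El M → El N → Set (o ⊔ ℓ)
  TpEq {A} {M} {N} p q a b =
    Σ[ E ∈ Model ] Σ[ g ∈ Emb M E ] Σ[ h ∈ Emb N E ]
      ((∀ (x : El A) → ⟦ g ⟧ (⟦ incl p ⟧ x) ≡ ⟦ h ⟧ (⟦ incl q ⟧ x))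
       × ⟦ g ⟧ a ≡ ⟦ h ⟧ b)

  MapsOnto : ∀ {X X' C C'} → Emb X C → Emb X' C' → Emb C C' → Set ℓ
  MapsOnto {X} {X'} i i' g =
    (∀ (x : El X) → ∃[ x' ] ⟦ g ⟧ (⟦ i ⟧ x) ≡ ⟦ i' ⟧ x') ×
    (∀ (x' : El X') → ∃[ x ] ⟦ g ⟧ (⟦ i ⟧ x) ≡ ⟦ i' ⟧ x')

record PreFrame {o ℓ : Level} (K : AECλ o ℓ) : Set (lsuc (o ⊔ ℓ)) where
  open AECλ K
  field
    -- basic types: bs p b  means  tp(b/A;N) ∈ S^bs(A)   (p : A ≤ N)
    bs     : ∀ {A N} → A ≤ N → El N → Set ℓ
    bs-inv : ∀ {A M N} (p : A ≤ M) (q : A ≤ N) (a : El M) (b : El N) →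
             TpEq K p q a b → bs p a → bs q b
    bs-na  : ∀ {A N} (p : A ≤ N) (b : El N) → bs p b → NotIn K p b
    -- NF p q c  means  ↓(A,B,c,C), i.e. tp(c/B;C) does not fork over A
    NF     : ∀ {A B C} → A ≤ B → B ≤ C → El C → Set ℓ
    -- invariance (together with monotonicity in the ambient model)
    NF-emb : ∀ {A B C A' B' C'} (p : A ≤ B) (q : B ≤ C)
               (p' : A' ≤ B') (q' : B' ≤ C') (g : Emb C C') →
             MapsOnto K (incl (≤-trans p q)) (incl (≤-trans p' q')) g →
             MapsOnto K (incl q) (incl q') g →
             ∀ (c : El C) → NF p q c → NF p' q' (⟦ g ⟧ c)
    NF-mono : ∀ {A A' B' B C} (r : A ≤ A') (p' : A' ≤ B') (s : B' ≤ B)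
                (q : B ≤ C) (c : El C) →
              NF (≤-trans r (≤-trans p' s)) q c → NF p' (≤-trans s q) c
    NF-down : ∀ {A B C'' C} (p : A ≤ B) (q'' : B ≤ C'') (t : C'' ≤ C)
                (c : El C'') →
              NF p (≤-trans q'' t) (⟦ incl t ⟧ c) → NF p q'' c

module _ {o ℓ : Level} {K : AECλ o ℓ} (𝔰 : PreFrame K) where
  open AECλ K
  open PreFrame 𝔰

  -- (A,B,b) ∈ K^{3,bs}  (A <_K B is given separately)
  InK3bs : ∀ {A B} → A ≤ B → El B → Set ℓ
  InK3bs p b = NotIn K p b × bs p b

  -- a λ-amalgamation (f, id_C, D) of B and C over A
  record Amalg {A B C : Model} (pAB : A ≤ B) (pAC : A ≤ C) : Set (o ⊔ ℓ) where
    field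
      D     : Model
      pCD   : C ≤ D
      f     : Emb B D
      fix-A : ∀ (a : El A) → ⟦ f ⟧ (⟦ incl pAB ⟧ a) ≡ ⟦ incl (≤-trans pAC pCD) ⟧ a

  AmEquiv : ∀ {A B C} {pAB : A ≤ B} {pAC : A ≤ C} →
            Amalg pAB pAC → Amalg pAB pAC → Set (o ⊔ ℓ)
  AmEquiv {B = B} {C = C} α β =
    Σ[ E ∈ Model ] Σ[ g ∈ Emb (Amalg.D α) E ] Σ[ h ∈ Emb (Amalg.D β) E ]
      ((∀ (x : El B) → ⟦ g ⟧ (⟦ Amalg.f α ⟧ x) ≡ ⟦ h ⟧ (⟦ Amalg.f β ⟧ x)) ×
       (∀ (y : El C) → ⟦ g ⟧ (⟦ incl (Amalg.pCD α) ⟧ y) ≡ ⟦ h ⟧ (⟦ incl (Amalg.pCD β) ⟧ y)))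

  Witness : ∀ {A B C} (pAB : A ≤ B) (pAC : A ≤ C) → El B → Set (o ⊔ ℓ)
  Witness pAB pAC b =
    Σ[ α ∈ Amalg pAB pAC ] Σ[ β ∈ Amalg pAB pAC ]
      (¬ AmEquiv α β ×
       TpEq K (Amalg.pCD α) (Amalg.pCD β) (⟦ Amalg.f α ⟧ b) (⟦ Amalg.f β ⟧ b) ×
       NF pAC (Amalg.pCD α) (⟦ Amalg.f α ⟧ b))

module Submission where

-- Let α, β be the two amalgamations of B and C
-- over A witnessing non-uniqueness for (A,B,b).  By amalgamation each one
-- extends along B ≤ B*: amalgamate f : B → D with B ≤ B* to obtain
-- D ≤ D* and g : B* → D* agreeing with f on B.  The extensions α*, β* are
-- amalgamations of B* and C over A, and
--   * they are not equivalent, since an equivalence of α*, β* restricts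
--     (through D ≤ D*) to an equivalence of α, β;
--   * b has the same Galois type over C in both, because equality of Galois
--     types is preserved when the ambient models grow strongly;
--   * that type does not fork over A, since by invariance non-forking is
--     preserved when the ambient model grows strongly.

open import Level using (Level; _⊔_)
open import Defs
open import Data.Product using (_,_)
open import Relation.Binary.PropositionalEquality
  using (_≡_; sym; trans; cong; subst; subst₂; module ≡-Reasoning)

module Extensions {o ℓ : Level} (K : AECλ o ℓ) where
  open AECλ K
  open ≡-Reasoning

  -- Since ≤_K is proof-irrelevant, any two inclusion maps M → N agree.
  incl-irrelevant : ∀ {M N} (p q : M ≤ N) (x : El M) →
                    ⟦ incl p ⟧ x ≡ ⟦ incl q ⟧ x
  incl-irrelevant p q x = cong (λ r → ⟦ incl r ⟧ x) (≤-prop p q)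

  incl-mapsOnto : ∀ {X D D*} (s : X ≤ D) (r : D ≤ D*) (t : X ≤ D*) →
                  MapsOnto K (incl s) (incl t) (incl r)
  incl-mapsOnto s r t = (λ x → x , same x) , (λ x → x , same x)
    where
    same : ∀ x → ⟦ incl r ⟧ (⟦ incl s ⟧ x) ≡ ⟦ incl t ⟧ x
    same x = trans (sym (incl-trans s r x)) (incl-irrelevant (≤-trans s r) t x)

  tpEq-extend : ∀ {X M N M* N*} {p : X ≤ M} {q : X ≤ N}
                (r : M ≤ M*) (s : N ≤ N*) {a : El M} {b : El N} →
                TpEq K p q a b →
                TpEq K (≤-trans p r) (≤-trans q s) (⟦ incl r ⟧ a) (⟦ incl s ⟧ b)
  tpEq-extend {p = p} {q} r s {a} {b} (E , e₁ , e₂ , onX , onPt)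
    with amalgamation e₁ (incl r)
  ... | E₁ , q₁ , k , square₁
    with amalgamation (incl q₁ ∘E e₂) (incl s)
  ... | E₂ , q₂ , k₂ , square₂ =
    E₂ , G , k₂ , onX* , glue a b onPt
    where
    -- M* and N* land in E₂ via E ≤ E₁ ≤ E₂ and the amalgamation maps.
    G : Emb _ E₂
    G = incl q₂ ∘E k

    glue : ∀ x y → ⟦ e₁ ⟧ x ≡ ⟦ e₂ ⟧ y →
           ⟦ G ⟧ (⟦ incl r ⟧ x) ≡ ⟦ k₂ ⟧ (⟦ incl s ⟧ y)
    glue x y e = begin
      ⟦ G ⟧ (⟦ incl r ⟧ x)                   ≡⟨ ⟦∘E⟧ (incl q₂) k _ ⟩
      ⟦ incl q₂ ⟧ (⟦ k ⟧ (⟦ incl r ⟧ x))     ≡⟨ cong ⟦ incl q₂ ⟧ (sym (square₁ x)) ⟩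
      ⟦ incl q₂ ⟧ (⟦ incl q₁ ⟧ (⟦ e₁ ⟧ x))   ≡⟨ cong (λ z → ⟦ incl q₂ ⟧ (⟦ incl q₁ ⟧ z)) e ⟩
      ⟦ incl q₂ ⟧ (⟦ incl q₁ ⟧ (⟦ e₂ ⟧ y))   ≡⟨ cong ⟦ incl q₂ ⟧ (sym (⟦∘E⟧ (incl q₁) e₂ y)) ⟩
      ⟦ incl q₂ ⟧ (⟦ incl q₁ ∘E e₂ ⟧ y)      ≡⟨ square₂ y ⟩
      ⟦ k₂ ⟧ (⟦ incl s ⟧ y)                  ∎

    onX* : ∀ x → ⟦ G ⟧ (⟦ incl (≤-trans p r) ⟧ x) ≡ ⟦ k₂ ⟧ (⟦ incl (≤-trans q s) ⟧ x)
    onX* x = begin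
      ⟦ G ⟧ (⟦ incl (≤-trans p r) ⟧ x)       ≡⟨ cong ⟦ G ⟧ (incl-trans p r x) ⟩
      ⟦ G ⟧ (⟦ incl r ⟧ (⟦ incl p ⟧ x))      ≡⟨ glue _ _ (onX x) ⟩
      ⟦ k₂ ⟧ (⟦ incl s ⟧ (⟦ incl q ⟧ x))     ≡⟨ cong ⟦ k₂ ⟧ (sym (incl-trans q s x)) ⟩
      ⟦ k₂ ⟧ (⟦ incl (≤-trans q s) ⟧ x)      ∎

module Frame {o ℓ : Level} {K : AECλ o ℓ} (𝔰 : PreFrame K) where
  open AECλ K
  open PreFrame 𝔰
  open Extensions K
  open ≡-Reasoning

  nf-extend : ∀ {A B D D*} (p : A ≤ B) (q : B ≤ D) (r : D ≤ D*) (c : El D) →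
              NF p q c → NF p (≤-trans q r) (⟦ incl r ⟧ c)
  nf-extend p q r c =
    NF-emb p q p (≤-trans q r) (incl r)
      (incl-mapsOnto (≤-trans p q) r (≤-trans p (≤-trans q r)))
      (incl-mapsOnto q r (≤-trans q r)) c

  record Extension {A B B* C} {pAB : A ≤ B} {pAC : A ≤ C}
                   (α : Amalg 𝔰 pAB pAC) (pBB* : B ≤ B*) : Set (o ⊔ ℓ) where
    open Amalg α
    field
      D*     : Model
      pDD*   : D ≤ D*
      g      : Emb B* D*
      agrees : ∀ x → ⟦ incl pDD* ⟧ (⟦ f ⟧ x) ≡ ⟦ g ⟧ (⟦ incl pBB* ⟧ x)

    amalg : Amalg 𝔰 (≤-trans pAB pBB*) pAC
    amalg = record { D = D* ; pCD = ≤-trans pCD pDD* ; f = g ; fix-A = fixes-A }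
      where
      fixes-A : ∀ a → ⟦ g ⟧ (⟦ incl (≤-trans pAB pBB*) ⟧ a) ≡
                      ⟦ incl (≤-trans pAC (≤-trans pCD pDD*)) ⟧ a
      fixes-A a = begin
        ⟦ g ⟧ (⟦ incl (≤-trans pAB pBB*) ⟧ a)      ≡⟨ cong ⟦ g ⟧ (incl-trans pAB pBB* a) ⟩
        ⟦ g ⟧ (⟦ incl pBB* ⟧ (⟦ incl pAB ⟧ a))     ≡⟨ sym (agrees _) ⟩
        ⟦ incl pDD* ⟧ (⟦ f ⟧ (⟦ incl pAB ⟧ a))     ≡⟨ cong ⟦ incl pDD* ⟧ (fix-A a) ⟩
        ⟦ incl pDD* ⟧ (⟦ incl (≤-trans pAC pCD) ⟧ a)
          ≡⟨ sym (incl-trans (≤-trans pAC pCD) pDD* a) ⟩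
        ⟦ incl (≤-trans (≤-trans pAC pCD) pDD*) ⟧ a
          ≡⟨ incl-irrelevant _ _ a ⟩
        ⟦ incl (≤-trans pAC (≤-trans pCD pDD*)) ⟧ a ∎

  extend : ∀ {A B B* C} {pAB : A ≤ B} {pAC : A ≤ C}
           (α : Amalg 𝔰 pAB pAC) (pBB* : B ≤ B*) → Extension α pBB*
  extend α pBB* with amalgamation (Amalg.f α) (incl pBB*)
  ... | D* , pDD* , g , agrees =
    record { D* = D* ; pDD* = pDD* ; g = g ; agrees = agrees }

  equiv-restrict : ∀ {A B B* C} {pAB : A ≤ B} {pAC : A ≤ C} {pBB* : B ≤ B*}
                   {α β : Amalg 𝔰 pAB pAC}
                   (X : Extension α pBB*) (Y : Extension β pBB*) →
                   AmEquiv 𝔰 (Extension.amalg X) (Extension.amalg Y) →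
                   AmEquiv 𝔰 α β
  equiv-restrict {pBB* = pBB*} {α} {β} X Y (E , h₁ , h₂ , onB* , onC) =
    E , h₁ ∘E incl X.pDD* , h₂ ∘E incl Y.pDD* , onB , onC'
    where
    module X = Extension X
    module Y = Extension Y
    onB : ∀ x → ⟦ h₁ ∘E incl X.pDD* ⟧ (⟦ Amalg.f α ⟧ x) ≡ ⟦ h₂ ∘E incl Y.pDD* ⟧ (⟦ Amalg.f β ⟧ x)
    onB x = begin
      ⟦ h₁ ∘E incl X.pDD* ⟧ (⟦ Amalg.f α ⟧ x)  ≡⟨ ⟦∘E⟧ h₁ _ _ ⟩
      ⟦ h₁ ⟧ (⟦ incl X.pDD* ⟧ (⟦ Amalg.f α ⟧ x)) ≡⟨ cong ⟦ h₁ ⟧ (X.agrees x) ⟩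
      ⟦ h₁ ⟧ (⟦ X.g ⟧ (⟦ incl pBB* ⟧ x))        ≡⟨ onB* _ ⟩
      ⟦ h₂ ⟧ (⟦ Y.g ⟧ (⟦ incl pBB* ⟧ x))        ≡⟨ cong ⟦ h₂ ⟧ (sym (Y.agrees x)) ⟩
      ⟦ h₂ ⟧ (⟦ incl Y.pDD* ⟧ (⟦ Amalg.f β ⟧ x)) ≡⟨ sym (⟦∘E⟧ h₂ _ _) ⟩
      ⟦ h₂ ∘E incl Y.pDD* ⟧ (⟦ Amalg.f β ⟧ x)  ∎
    onC' : ∀ y → ⟦ h₁ ∘E incl X.pDD* ⟧ (⟦ incl (Amalg.pCD α) ⟧ y) ≡
                 ⟦ h₂ ∘E incl Y.pDD* ⟧ (⟦ incl (Amalg.pCD β) ⟧ y)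
    onC' y = begin
      ⟦ h₁ ∘E incl X.pDD* ⟧ (⟦ incl (Amalg.pCD α) ⟧ y)  ≡⟨ ⟦∘E⟧ h₁ _ _ ⟩
      ⟦ h₁ ⟧ (⟦ incl X.pDD* ⟧ (⟦ incl (Amalg.pCD α) ⟧ y)) ≡⟨ cong ⟦ h₁ ⟧ (sym (incl-trans _ X.pDD* y)) ⟩
      ⟦ h₁ ⟧ (⟦ incl (≤-trans (Amalg.pCD α) X.pDD*) ⟧ y) ≡⟨ onC y ⟩
      ⟦ h₂ ⟧ (⟦ incl (≤-trans (Amalg.pCD β) Y.pDD*) ⟧ y) ≡⟨ cong ⟦ h₂ ⟧ (incl-trans _ Y.pDD* y) ⟩
      ⟦ h₂ ⟧ (⟦ incl Y.pDD* ⟧ (⟦ incl (Amalg.pCD β) ⟧ y)) ≡⟨ sym (⟦∘E⟧ h₂ _ _) ⟩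
      ⟦ h₂ ∘E incl Y.pDD* ⟧ (⟦ incl (Amalg.pCD β) ⟧ y)  ∎

  witness-extend : ∀ {A B B* C} (pAB : A ≤ B) (pBB* : B ≤ B*) (pAC : A ≤ C) (b : El B) →
                   Witness 𝔰 pAB pAC b →
                   Witness 𝔰 (≤-trans pAB pBB*) pAC (⟦ incl pBB* ⟧ b)
  witness-extend pAB pBB* pAC b (α , β , inequivalent , sameType , nonForking) =
    X.amalg , Y.amalg , (λ e → inequivalent (equiv-restrict X Y e)) ,
    subst₂ (TpEq K _ _) (X.agrees b) (Y.agrees b)
      (tpEq-extend X.pDD* Y.pDD* sameType) ,
    subst (NF pAC _) (X.agrees b)
      (nf-extend pAC (Amalg.pCD α) X.pDD* _ nonForking)
    where
    X = extend α pBB*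
    Y = extend β pBB*
    module X = Extension X
    module Y = Extension Y

lemma10p20 : ∀ {o ℓ : Level} (K : AECλ o ℓ) (𝔰 : PreFrame K) →
    let open AECλ K in
    ∀ {A B B* C : Model} (pAB : A ≤ B) (pBB* : B ≤ B*) (pAC : A ≤ C) (b : El B) →
    Strict K pAB → Strict K pAC → InK3bs 𝔰 pAB b →
    Witness 𝔰 pAB pAC b →
    Witness 𝔰 (AECλ.≤-trans K pAB pBB*) pAC (AECλ.⟦_⟧ K (AECλ.incl K pBB*) b)
lemma10p20 K 𝔰 pAB pBB* pAC b _ _ _ witness =
  Frame.witness-extend 𝔰 pAB pBB* pAC b witness
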